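{- Let $d\ge 1$ and let $G=(A,B,E)$ be a $d$-regular bipartite graph on $2n$ vertices with colour classes $A$ and $B$. Define the polynomial $P_G(\underline{x})=\prod_{(u,v)\in E}(x_u+x_v)$ in variables $x_w$, $w\in A\cup B$, and let $\underline{\alpha}$ be the vector with $\alpha_u=1$ for $u\in A$ and $\alpha_v=d-1$ for $v\in B$. Then $$\mathrm{cap}_{\underline{\alpha}}(P_G)=\frac{d^{nd}}{(d-1)^{n(d-1)}}.$$
   Context: For a multivariate polynomial $P(x_1,\dots,x_n)$ with non-negative coefficients and a non-negative real vector $\underline{\alpha}=(\alpha_1,\dots,\alpha_n)$, the $\underline{\alpha}$-capacity is $\mathrm{cap}_{\underline{\alpha}}(P)=\inf_{x_1,\dots,x_n>0}\frac{P(x_1,\dots,x_n)}{\prod_{i=1}^n x_i^{\alpha_i}}$. The convention $0^0=1$ is used.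
   Formalization: The variables $x_w$ in the infimum defining the capacity $\mathrm{cap}_{\underline{\alpha}}(P_G)$ range over the positive rationals instead of the positive reals. -}

module Defs where

open import Data.Nat as ℕ using (ℕ; zero; suc)
open import Data.Nat.Properties using (m^n≢0)
open import Data.Fin using (Fin; zero; suc)
open import Data.Bool using (Bool; if_then_else_)
open import Data.Integer using (+_)
open import Data.Rational using (ℚ; 0ℚ; 1ℚ; _+_; _*_; _<_; _≤_; _/_)
open import Data.Product using (Σ; _×_)
open import Relation.Binary.PropositionalEquality using (_≡_)

sumℕ : (n : ℕ) → (Fin n → ℕ) → ℕ
sumℕ zero    f = 0
sumℕ (suc n) f = f zero ℕ.+ sumℕ n (λ i → f (suc i))

prodℚ : (n : ℕ) → (Fin n → ℚ) → ℚ
prodℚ zero    f = 1ℚ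
prodℚ (suc n) f = f zero * prodℚ n (λ i → f (suc i))

_^ℚ_ : ℚ → ℕ → ℚ
q ^ℚ zero  = 1ℚ
q ^ℚ suc k = q * (q ^ℚ k)

-- A bipartite (simple) graph with colour classes A = B = Fin n,
-- given by its bipartite adjacency relation: adj u v = true iff (u,v) ∈ E.
BipGraph : ℕ → Set
BipGraph n = Fin n → Fin n → Bool

indicator : Bool → ℕ
indicator b = if b then 1 else 0

degA : ∀ {n} → BipGraph n → Fin n → ℕ
degA {n} G u = sumℕ n (λ v → indicator (G u v))

degB : ∀ {n} → BipGraph n → Fin n → ℕ
degB {n} G v = sumℕ n (λ u → indicator (G u v))

Regular : ∀ {n} → ℕ → BipGraph n → Set
Regular d G = (∀ u → degA G u ≡ d) × (∀ v → degB G v ≡ d)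

PG : ∀ {n} → BipGraph n → (Fin n → ℚ) → (Fin n → ℚ) → ℚ
PG {n} G x y = prodℚ n (λ u → prodℚ n (λ v → if G u v then x u + y v else 1ℚ))

-- ∏_{w} x_w^{α_w} with α_u = 1 on A and α_v = d - 1 on B
monomial : (n d : ℕ) → (Fin n → ℚ) → (Fin n → ℚ) → ℚ
monomial n d x y = prodℚ n (λ u → x u ^ℚ 1) * prodℚ n (λ v → y v ^ℚ (d ℕ.∸ 1))

Pos : ∀ {n} → (Fin n → ℚ) → Set
Pos x = ∀ i → 0ℚ < x i

-- c = inf_{x,y > 0} P(x,y) / M(x,y), for a positive monomial M, written
-- without division: c is a lower bound (c·M ≤ P) and for every ε > 0 some
-- positive point gets below c + ε (P < (c+ε)·M).
-- Infimum taken over positive rationals.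
IsInfRatio : (n : ℕ) → ((Fin n → ℚ) → (Fin n → ℚ) → ℚ) →
             ((Fin n → ℚ) → (Fin n → ℚ) → ℚ) → ℚ → Set
IsInfRatio n P M c =
  (∀ x y → Pos x → Pos y → c * M x y ≤ P x y) ×
  (∀ ε → 0ℚ < ε → Σ (Fin n → ℚ) λ x → Σ (Fin n → ℚ) λ y →
       Pos x × Pos y × (P x y < (c + ε) * M x y))

Capacity : ∀ {n} → ℕ → BipGraph n → ℚ → Set
Capacity {n} d G c = IsInfRatio n (PG G) (monomial n d) c

-- d^{nd} / (d-1)^{n(d-1)}   (with 0^0 = 1 when d = 1)
capValue : ℕ → ℕ → ℚ
capValue n zero = 1ℚ   -- unused (d ≥ 1)
capValue n (suc zero) = 1ℚ   -- 1^n / 0^0 = 1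
capValue n d@(suc (suc k)) =
  _/_ (+ (d ℕ.^ (n ℕ.* d))) (suc k ℕ.^ (n ℕ.* suc k)) {{m^n≢0 (suc k) (n ℕ.* suc k)}}

{-# OPTIONS --safe #-}
module Submission where

-- For x, y > 0 and d = k + 1, weighted AM-GM (here a consequence of Bernoulli's inequality)
-- gives (k+1)^(k+1) x y^k ≤ k^k (x + y)^(k+1), with equality at y = k x.  Multiplying this
-- over the n d edges, regularity turns the left side into the d-th power of
-- (k+1)^((k+1)n) ∏ x_u ∏ y_v^k and the right side into the d-th power of k^(kn) P_G(x, y);
-- taking d-th roots gives the lower bound.  For d ≥ 2 it is attained at x ≡ 1, y ≡ k.  For
-- d = 1 the bound ∏ x_u ≤ P_G is only approached, along x ≡ 1, y ≡ δ → 0, using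
-- (1 + δ)^n ≤ 1 + δ (2^n - 1) for 0 ≤ δ ≤ 1.

open import Defs
open import Algebra.Bundles using (CommutativeRing)
open import Data.Bool using (Bool; true; false; if_then_else_)
open import Data.Fin using (Fin; zero; suc)
open import Data.Integer as ℤ using (+_; 1ℤ)
import Data.Integer.Properties as ℤₚ
open import Data.Integer.Tactic.RingSolver using (solve-∀)
open import Data.Nat using (ℕ; zero; suc; _≤_)
import Data.Nat as ℕ
import Data.Nat.Properties as ℕₚ
open import Data.Product using (Σ; _×_; _,_)
open import Data.Sum using (inj₁; inj₂)
open import Data.Rational as ℚ using (ℚ; 0ℚ; 1ℚ; _+_; _*_; _-_; _/_; 1/_; toℚᵘ)
  renaming (_≤_ to _≤ℚ_; _<_ to _<ℚ_)
import Data.Rational.Properties as ℚₚ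
open import Data.Rational.Solver using (module +-*-Solver)
import Data.Rational.Unnormalised as ℚᵘ
import Data.Rational.Unnormalised.Properties as ℚᵘₚ
open import Relation.Binary.PropositionalEquality
  using (_≡_; refl; sym; trans; cong; cong₂; module ≡-Reasoning)

open import Algebra.Properties.CommutativeSemiring.Exp
  (CommutativeRing.commutativeSemiring ℚₚ.+-*-commutativeRing)
  using (_^_; ^-assocʳ; ^-distrib-*)
open import Algebra.Properties.Semiring.Mult (CommutativeRing.semiring ℚₚ.+-*-commutativeRing)
  using (×1-homo-*) renaming (_×_ to _·_)
open import Algebra.Properties.CommutativeMonoid.Sum ℚₚ.*-1-commutativeMonoid
  using (sum-cong-≗; sum-replicate; sum-replicate-zero; ∑-distrib-+; ∑-comm) renaming (sum to ∏)
open +-*-Solver using (solve; _:+_; _:*_; _:-_; _:=_; con)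

private
  variable
    n : ℕ
    p q r s : ℚ

0<1 : 0ℚ <ℚ 1ℚ
0<1 = ℚₚ.positive⁻¹ 1ℚ

0≤1 : 0ℚ ≤ℚ 1ℚ
0≤1 = ℚₚ.<⇒≤ 0<1

*-nonNeg : 0ℚ ≤ℚ p → 0ℚ ≤ℚ q → 0ℚ ≤ℚ p * q
*-nonNeg {p} {q} 0≤p 0≤q =
  ℚₚ.nonNegative⁻¹ _ {{ℚₚ.nonNeg*nonNeg⇒nonNeg p {{ℚ.nonNegative 0≤p}} q {{ℚ.nonNegative 0≤q}}}}

*-pos : 0ℚ <ℚ p → 0ℚ <ℚ q → 0ℚ <ℚ p * q
*-pos {p} {q} 0<p 0<q = ℚₚ.positive⁻¹ _ {{ℚₚ.pos*pos⇒pos p {{ℚ.positive 0<p}} q {{ℚ.positive 0<q}}}}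

+-nonNeg : 0ℚ ≤ℚ p → 0ℚ ≤ℚ q → 0ℚ ≤ℚ p + q
+-nonNeg = ℚₚ.+-mono-≤

+-pos : 0ℚ <ℚ p → 0ℚ ≤ℚ q → 0ℚ <ℚ p + q
+-pos = ℚₚ.+-mono-<-≤

*-mono-≤-nonNeg : 0ℚ ≤ℚ p → 0ℚ ≤ℚ r → p ≤ℚ q → r ≤ℚ s → p * r ≤ℚ q * s
*-mono-≤-nonNeg {p} {r} {q} {s} 0≤p 0≤r p≤q r≤s = ℚₚ.≤-trans
  (ℚₚ.*-monoˡ-≤-nonNeg p {{ℚ.nonNegative 0≤p}} r≤s)
  (ℚₚ.*-monoʳ-≤-nonNeg s {{ℚ.nonNegative (ℚₚ.≤-trans 0≤r r≤s)}} p≤q)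

p≤p+q : 0ℚ ≤ℚ q → p ≤ℚ p + q
p≤p+q {q} {p} 0≤q = ℚₚ.≤-trans (ℚₚ.≤-reflexive (sym (ℚₚ.+-identityʳ p))) (ℚₚ.+-monoʳ-≤ p 0≤q)

p<p+q : 0ℚ <ℚ q → p <ℚ p + q
p<p+q {q} {p} 0<q = ℚₚ.≤-<-trans (ℚₚ.≤-reflexive (sym (ℚₚ.+-identityʳ p))) (ℚₚ.+-monoʳ-< p 0<q)

square-nonNeg : ∀ p → 0ℚ ≤ℚ p * p
square-nonNeg p with ℚₚ.≤-total 0ℚ p
... | inj₁ 0≤p = *-nonNeg 0≤p 0≤p
... | inj₂ p≤0 = ℚₚ.nonNegative⁻¹ _
  {{ℚₚ.nonPos*nonPos⇒nonPos p {{ℚ.nonPositive p≤0}} p {{ℚ.nonPositive p≤0}}}}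

^-nonNeg : ∀ k → 0ℚ ≤ℚ p → 0ℚ ≤ℚ p ^ k
^-nonNeg zero    0≤p = 0≤1
^-nonNeg (suc k) 0≤p = *-nonNeg 0≤p (^-nonNeg k 0≤p)

^-pos : ∀ k → 0ℚ <ℚ p → 0ℚ <ℚ p ^ k
^-pos zero    0<p = 0<1
^-pos (suc k) 0<p = *-pos 0<p (^-pos k 0<p)

^-mono-≤ : ∀ k → 0ℚ ≤ℚ p → p ≤ℚ q → p ^ k ≤ℚ q ^ k
^-mono-≤ zero    0≤p p≤q = ℚₚ.≤-refl
^-mono-≤ (suc k) 0≤p p≤q = *-mono-≤-nonNeg 0≤p (^-nonNeg k 0≤p) p≤q (^-mono-≤ k 0≤p p≤q)

^-mono-< : ∀ k → 0ℚ ≤ℚ p → p <ℚ q → p ^ suc k <ℚ q ^ suc k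
^-mono-< {p} {q} k 0≤p p<q = ℚₚ.≤-<-trans
  (ℚₚ.*-monoˡ-≤-nonNeg p {{ℚ.nonNegative 0≤p}} (^-mono-≤ k 0≤p (ℚₚ.<⇒≤ p<q)))
  (ℚₚ.*-monoˡ-<-pos (q ^ k) {{ℚ.positive (^-pos k (ℚₚ.≤-<-trans 0≤p p<q))}} p<q)

^-cancel-≤ : ∀ k → 0ℚ ≤ℚ q → p ^ suc k ≤ℚ q ^ suc k → p ≤ℚ q
^-cancel-≤ k 0≤q pᵏ≤qᵏ = ℚₚ.≮⇒≥ λ q<p → ℚₚ.<-irrefl refl (ℚₚ.<-≤-trans (^-mono-< k 0≤q q<p) pᵏ≤qᵏ)

1^n≡1 : ∀ n → 1ℚ ^ n ≡ 1ℚ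
1^n≡1 n = trans (sym (sum-replicate n)) (sum-replicate-zero n)

^ℚ≡^ : ∀ p k → p ^ℚ k ≡ p ^ k
^ℚ≡^ p zero    = refl
^ℚ≡^ p (suc k) = cong (p *_) (^ℚ≡^ p k)

prodℚ≡∏ : ∀ n (f : Fin n → ℚ) → prodℚ n f ≡ ∏ f
prodℚ≡∏ zero    f = refl
prodℚ≡∏ (suc n) f = cong (f zero *_) (prodℚ≡∏ n (λ i → f (suc i)))

∏-^ : (f : Fin n → ℚ) (k : ℕ) → ∏ (λ i → f i ^ k) ≡ ∏ f ^ k
∏-^ {n} f zero    = sum-replicate-zero n
∏-^     f (suc k) = trans (∑-distrib-+ f (λ i → f i ^ k)) (cong (∏ f *_) (∏-^ f k))

∏-nonNeg : (f : Fin n → ℚ) → (∀ i → 0ℚ ≤ℚ f i) → 0ℚ ≤ℚ ∏ f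
∏-nonNeg {zero}  f 0≤f = 0≤1
∏-nonNeg {suc n} f 0≤f = *-nonNeg (0≤f zero) (∏-nonNeg (λ i → f (suc i)) (λ i → 0≤f (suc i)))

∏-mono-≤ : (f g : Fin n → ℚ) → (∀ i → 0ℚ ≤ℚ f i) → (∀ i → f i ≤ℚ g i) → ∏ f ≤ℚ ∏ g
∏-mono-≤ {zero}  f g 0≤f f≤g = ℚₚ.≤-refl
∏-mono-≤ {suc n} f g 0≤f f≤g = *-mono-≤-nonNeg (0≤f zero) (∏-nonNeg _ (λ i → 0≤f (suc i))) (f≤g zero)
  (∏-mono-≤ (λ i → f (suc i)) (λ i → g (suc i)) (λ i → 0≤f (suc i)) (λ i → f≤g (suc i)))

_^[_] : ℚ → Bool → ℚ
q ^[ b ] = if b then q else 1ℚ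

*-^[] : ∀ b p q → (p * q) ^[ b ] ≡ p ^[ b ] * q ^[ b ]
*-^[] true  p q = refl
*-^[] false p q = refl

^-^[] : ∀ b p k → (p ^ k) ^[ b ] ≡ p ^[ b ] ^ k
^-^[] true  p k = refl
^-^[] false p k = sym (1^n≡1 k)

^[]-nonNeg : ∀ b → 0ℚ ≤ℚ p → 0ℚ ≤ℚ p ^[ b ]
^[]-nonNeg true  0≤p = 0≤p
^[]-nonNeg false 0≤p = 0≤1

^[]-mono-≤ : ∀ b → p ≤ℚ q → p ^[ b ] ≤ℚ q ^[ b ]
^[]-mono-≤ true  p≤q = p≤q
^[]-mono-≤ false p≤q = ℚₚ.≤-refl

∏-^[] : ∀ q (b : Fin n → Bool) → ∏ (λ i → q ^[ b i ]) ≡ q ^ sumℕ n (λ i → indicator (b i))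
∏-^[] {zero}  q b = refl
∏-^[] {suc n} q b with b zero
... | true  = cong (q *_) (∏-^[] q (λ i → b (suc i)))
... | false = trans (ℚₚ.*-identityˡ _) (∏-^[] q (λ i → b (suc i)))

fromℕ : ℕ → ℚ
fromℕ m = m · 1ℚ

fromℕ-nonNeg : ∀ m → 0ℚ ≤ℚ fromℕ m
fromℕ-nonNeg zero    = ℚₚ.≤-refl
fromℕ-nonNeg (suc m) = +-nonNeg 0≤1 (fromℕ-nonNeg m)

fromℕ-pos : ∀ m → 0ℚ <ℚ fromℕ (suc m)
fromℕ-pos m = +-pos 0<1 (fromℕ-nonNeg m)

fromℕ-^ : ∀ m k → fromℕ (m ℕ.^ k) ≡ fromℕ m ^ k
fromℕ-^ m zero    = refl
fromℕ-^ m (suc k) = trans (×1-homo-* m (m ℕ.^ k)) (cong (fromℕ m *_) (fromℕ-^ m k))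

toℚᵘ-fromℕ : ∀ m → toℚᵘ (fromℕ m) ℚᵘ.≃ ℚᵘ.mkℚᵘ (+ m) 0
toℚᵘ-fromℕ zero    = ℚᵘₚ.≃-refl
toℚᵘ-fromℕ (suc m) = begin
  toℚᵘ (1ℚ + fromℕ m)               ≈⟨ ℚₚ.toℚᵘ-homo-+ 1ℚ (fromℕ m) ⟩
  ℚᵘ.1ℚᵘ ℚᵘ.+ toℚᵘ (fromℕ m)        ≈⟨ ℚᵘₚ.+-congʳ ℚᵘ.1ℚᵘ (toℚᵘ-fromℕ m) ⟩
  ℚᵘ.1ℚᵘ ℚᵘ.+ ℚᵘ.mkℚᵘ (+ m) 0       ≈⟨ ℚᵘ.*≡* (numerators (+ m)) ⟩
  ℚᵘ.mkℚᵘ (+ suc m) 0               ∎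
  where
  open ℚᵘₚ.≃-Reasoning
  numerators : ∀ i → (1ℤ ℤ.* 1ℤ ℤ.+ i ℤ.* 1ℤ) ℤ.* 1ℤ ≡ (1ℤ ℤ.+ i) ℤ.* (1ℤ ℤ.* 1ℤ)
  numerators = solve-∀

-- `_/_` normalises by the gcd, so the identity is checked on unnormalised representatives.
+m/n*n≡m : ∀ m n .{{_ : ℕ.NonZero n}} → (+ m / n) * fromℕ n ≡ fromℕ m
+m/n*n≡m m n@(suc n-1) = ℚₚ.toℚᵘ-injective (begin
  toℚᵘ (+ m / n * fromℕ n)                    ≈⟨ ℚₚ.toℚᵘ-homo-* (+ m / n) (fromℕ n) ⟩
  toℚᵘ (+ m / n) ℚᵘ.* toℚᵘ (fromℕ n)          ≈⟨ ℚᵘₚ.*-cong (ℚₚ.toℚᵘ-fromℚᵘ (ℚᵘ.mkℚᵘ (+ m) n-1)) (toℚᵘ-fromℕ n) ⟩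
  ℚᵘ.mkℚᵘ (+ m) n-1 ℚᵘ.* ℚᵘ.mkℚᵘ (+ n) 0      ≈⟨ ℚᵘ.*≡* (ℤₚ.*-assoc (+ m) (+ n) 1ℤ) ⟩
  ℚᵘ.mkℚᵘ (+ m) 0                             ≈⟨ ℚᵘₚ.≃-sym (toℚᵘ-fromℕ m) ⟩
  toℚᵘ (fromℕ m)                              ∎)
  where open ℚᵘₚ.≃-Reasoning

capValue-as-ratio : ∀ n k → capValue n (suc k) * (fromℕ k ^ k) ^ n ≡ (fromℕ (suc k) ^ suc k) ^ n
capValue-as-ratio n zero    = ℚₚ.*-identityˡ _
capValue-as-ratio n k@(suc _) = begin
  c * (fromℕ k ^ k) ^ n          ≡⟨ cong (c *_) (^-assocʳ (fromℕ k) k n) ⟩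
  c * fromℕ k ^ (k ℕ.* n)        ≡⟨ cong (λ e → c * fromℕ k ^ e) (ℕₚ.*-comm k n) ⟩
  c * fromℕ k ^ (n ℕ.* k)        ≡⟨ cong (c *_) (sym (fromℕ-^ k (n ℕ.* k))) ⟩
  c * fromℕ (k ℕ.^ (n ℕ.* k))    ≡⟨ +m/n*n≡m (d ℕ.^ (n ℕ.* d)) (k ℕ.^ (n ℕ.* k)) {{ℕₚ.m^n≢0 k (n ℕ.* k)}} ⟩
  fromℕ (d ℕ.^ (n ℕ.* d))        ≡⟨ fromℕ-^ d (n ℕ.* d) ⟩
  fromℕ d ^ (n ℕ.* d)            ≡⟨ cong (fromℕ d ^_) (ℕₚ.*-comm n d) ⟩
  fromℕ d ^ (d ℕ.* n)            ≡⟨ sym (^-assocʳ (fromℕ d) d n) ⟩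
  (fromℕ d ^ d) ^ n              ∎
  where
  open ≡-Reasoning
  d = suc k
  c = capValue n d

bernoulli : ∀ m {s a} → 0ℚ ≤ℚ s → 0ℚ ≤ℚ s + a → s ^ m * (s + fromℕ (suc m) * a) ≤ℚ (s + a) ^ suc m
bernoulli zero {s} {a} 0≤s 0≤s+a = ℚₚ.≤-reflexive (base s a)
  where
  base : ∀ s a → 1ℚ * (s + 1ℚ * a) ≡ (s + a) * 1ℚ
  base = solve 2 (λ s a → con 1ℚ :* (s :+ con 1ℚ :* a) := (s :+ a) :* con 1ℚ) refl
bernoulli (suc m) {s} {a} 0≤s 0≤s+a = begin
  s ^ suc m * (s + (1ℚ + M) * a)                    ≤⟨ p≤p+q (*-nonNeg (^-nonNeg m 0≤s) (*-nonNeg (fromℕ-nonNeg (suc m)) (square-nonNeg a))) ⟩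
  s * s ^ m * (s + (1ℚ + M) * a) + s ^ m * (M * (a * a)) ≡⟨ step (s ^ m) s a M ⟨
  (s + a) * (s ^ m * (s + M * a))                   ≤⟨ ℚₚ.*-monoˡ-≤-nonNeg (s + a) {{ℚ.nonNegative 0≤s+a}} (bernoulli m 0≤s 0≤s+a) ⟩
  (s + a) * (s + a) ^ suc m                         ∎
  where
  open ℚₚ.≤-Reasoning
  M = fromℕ (suc m)
  step : ∀ t s a M → (s + a) * (t * (s + M * a)) ≡ s * t * (s + (1ℚ + M) * a) + t * (M * (a * a))
  step = solve 4 (λ t s a M → (s :+ a) :* (t :* (s :+ M :* a))
                             := s :* t :* (s :+ (con 1ℚ :+ M) :* a) :+ t :* (M :* (a :* a))) refl

weighted-am-gm : ∀ k {x y} → 0ℚ <ℚ x → 0ℚ <ℚ y →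
                 fromℕ (suc k) ^ suc k * (x * y ^ k) ≤ℚ fromℕ k ^ k * (x + y) ^ suc k
weighted-am-gm zero {x} {y} 0<x 0<y = begin
  1ℚ * (x * 1ℚ)       ≡⟨ solve 1 (λ x → con 1ℚ :* (x :* con 1ℚ) := x) refl x ⟩
  x                   ≤⟨ p≤p+q (ℚₚ.<⇒≤ 0<y) ⟩
  x + y               ≡⟨ solve 2 (λ x y → x :+ y := con 1ℚ :* ((x :+ y) :* con 1ℚ)) refl x y ⟩
  1ℚ * ((x + y) * 1ℚ) ∎
  where open ℚₚ.≤-Reasoning
weighted-am-gm k@(suc j) {x} {y} 0<x 0<y = ℚₚ.*-cancelˡ-≤-pos K {{ℚ.positive (fromℕ-pos j)}} (begin
  K * (D ^ suc k * (x * y ^ k))                 ≡⟨ split (D ^ k) (y ^ k) D K x y ⟩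
  (D ^ k * y ^ k) * (D * y + D * (K * x - y))   ≡⟨ cong (_* (D * y + D * (K * x - y))) (^-distrib-* D y k) ⟨
  (D * y) ^ k * (D * y + D * (K * x - y))       ≤⟨ bernoulli k 0≤Dy 0≤K[x+y] ⟩
  (D * y + (K * x - y)) ^ suc k                 ≡⟨ cong (_^ suc k) (regroup K x y) ⟩
  (K * (x + y)) ^ suc k                         ≡⟨ ^-distrib-* K (x + y) (suc k) ⟩
  K * K ^ k * (x + y) ^ suc k                   ≡⟨ ℚₚ.*-assoc K (K ^ k) _ ⟩
  K * (K ^ k * (x + y) ^ suc k)                 ∎)
  where
  open ℚₚ.≤-Reasoning
  K = fromℕ k
  D = fromℕ (suc k)
  split : ∀ Dᵏ yᵏ D K x y → K * (D * Dᵏ * (x * yᵏ)) ≡ (Dᵏ * yᵏ) * (D * y + D * (K * x - y))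
  split = solve 6 (λ Dᵏ yᵏ D K x y → K :* (D :* Dᵏ :* (x :* yᵏ))
                                     := (Dᵏ :* yᵏ) :* (D :* y :+ D :* (K :* x :- y))) refl
  regroup : ∀ K x y → (1ℚ + K) * y + (K * x - y) ≡ K * (x + y)
  regroup = solve 3 (λ K x y → (con 1ℚ :+ K) :* y :+ (K :* x :- y) := K :* (x :+ y)) refl
  0≤Dy : 0ℚ ≤ℚ D * y
  0≤Dy = *-nonNeg (fromℕ-nonNeg (suc k)) (ℚₚ.<⇒≤ 0<y)
  0≤K[x+y] : 0ℚ ≤ℚ D * y + (K * x - y)
  0≤K[x+y] = ℚₚ.≤-trans (*-nonNeg (fromℕ-nonNeg k) (+-nonNeg (ℚₚ.<⇒≤ 0<x) (ℚₚ.<⇒≤ 0<y)))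
                        (ℚₚ.≤-reflexive (sym (regroup K x y)))

mersenne : ℕ → ℚ
mersenne zero    = 0ℚ
mersenne (suc n) = mersenne n + mersenne n + 1ℚ

mersenne-nonNeg : ∀ n → 0ℚ ≤ℚ mersenne n
mersenne-nonNeg zero    = ℚₚ.≤-refl
mersenne-nonNeg (suc n) = +-nonNeg (+-nonNeg (mersenne-nonNeg n) (mersenne-nonNeg n)) 0≤1

[1+δ]^n≤1+δ*mersenne : ∀ n {δ} → 0ℚ ≤ℚ δ → δ ≤ℚ 1ℚ → (1ℚ + δ) ^ n ≤ℚ 1ℚ + δ * mersenne n
[1+δ]^n≤1+δ*mersenne zero {δ}   0≤δ δ≤1 = ℚₚ.≤-reflexive (solve 1 (λ δ → con 1ℚ := con 1ℚ :+ δ :* con 0ℚ) refl δ)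
[1+δ]^n≤1+δ*mersenne (suc n) {δ} 0≤δ δ≤1 = begin
  (1ℚ + δ) * (1ℚ + δ) ^ n                 ≤⟨ ℚₚ.*-monoˡ-≤-nonNeg (1ℚ + δ) {{ℚ.nonNegative 0≤1+δ}} ([1+δ]^n≤1+δ*mersenne n 0≤δ δ≤1) ⟩
  (1ℚ + δ) * (1ℚ + δ * B)                 ≡⟨ expand δ B ⟩
  (1ℚ + δ * B + δ) + δ * (δ * B)          ≤⟨ ℚₚ.+-monoʳ-≤ (1ℚ + δ * B + δ) (ℚₚ.*-monoʳ-≤-nonNeg (δ * B) {{ℚ.nonNegative 0≤δB}} δ≤1) ⟩
  (1ℚ + δ * B + δ) + 1ℚ * (δ * B)         ≡⟨ collect δ B ⟩
  1ℚ + δ * (B + B + 1ℚ)                   ∎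
  where
  open ℚₚ.≤-Reasoning
  B = mersenne n
  0≤1+δ : 0ℚ ≤ℚ 1ℚ + δ
  0≤1+δ = +-nonNeg 0≤1 0≤δ
  0≤δB : 0ℚ ≤ℚ δ * B
  0≤δB = *-nonNeg 0≤δ (mersenne-nonNeg n)
  expand : ∀ δ B → (1ℚ + δ) * (1ℚ + δ * B) ≡ (1ℚ + δ * B + δ) + δ * (δ * B)
  expand = solve 2 (λ δ B → (con 1ℚ :+ δ) :* (con 1ℚ :+ δ :* B) := (con 1ℚ :+ δ :* B :+ δ) :+ δ :* (δ :* B)) refl
  collect : ∀ δ B → (1ℚ + δ * B + δ) + 1ℚ * (δ * B) ≡ 1ℚ + δ * (B + B + 1ℚ)
  collect = solve 2 (λ δ B → (con 1ℚ :+ δ :* B :+ δ) :+ con 1ℚ :* (δ :* B) := con 1ℚ :+ δ :* (B :+ B :+ con 1ℚ)) refl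

small-δ : ∀ {q ε} → 0ℚ ≤ℚ q → 0ℚ <ℚ ε → Σ ℚ λ δ → 0ℚ <ℚ δ × δ ≤ℚ 1ℚ × δ * q <ℚ ε
small-δ {q} {ε} 0≤q 0<ε = δ , 0<δ , δ≤1 , δq<ε
  where
  open ℚₚ.≤-Reasoning
  ρ = 1ℚ + ε + q
  0<ρ : 0ℚ <ℚ ρ
  0<ρ = +-pos (+-pos 0<1 (ℚₚ.<⇒≤ 0<ε)) 0≤q
  instance
    ρ-pos : ℚ.Positive ρ
    ρ-pos = ℚ.positive 0<ρ
    ρ-nonZero : ℚ.NonZero ρ
    ρ-nonZero = ℚₚ.pos⇒nonZero ρ
  δ = ε * 1/ ρ
  0<δ : 0ℚ <ℚ δ
  0<δ = *-pos 0<ε (ℚₚ.positive⁻¹ (1/ ρ) {{ℚₚ.1/pos⇒pos ρ}})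
  δρ≡ε : δ * ρ ≡ ε
  δρ≡ε = trans (ℚₚ.*-assoc ε (1/ ρ) ρ) (trans (cong (ε *_) (ℚₚ.*-inverseˡ ρ)) (ℚₚ.*-identityʳ ε))
  δ≤1 : δ ≤ℚ 1ℚ
  δ≤1 = ℚₚ.*-cancelʳ-≤-pos ρ (begin
    δ * ρ          ≡⟨ δρ≡ε ⟩
    ε              ≤⟨ p≤p+q (+-nonNeg 0≤1 0≤q) ⟩
    ε + (1ℚ + q)   ≡⟨ solve 2 (λ ε q → ε :+ (con 1ℚ :+ q) := con 1ℚ :* (con 1ℚ :+ ε :+ q)) refl ε q ⟩
    1ℚ * ρ         ∎)
  δq<ε : δ * q <ℚ ε
  δq<ε = begin-strict
    δ * q                      <⟨ p<p+q (*-pos 0<δ (+-pos 0<1 (ℚₚ.<⇒≤ 0<ε))) ⟩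
    δ * q + δ * (1ℚ + ε)       ≡⟨ solve 3 (λ δ ε q → δ :* q :+ δ :* (con 1ℚ :+ ε) := δ :* (con 1ℚ :+ ε :+ q)) refl δ ε q ⟩
    δ * ρ                      ≡⟨ δρ≡ε ⟩
    ε                          ∎

^-^-comm : ∀ p m k → (p ^ m) ^ k ≡ (p ^ k) ^ m
^-^-comm p m k = trans (^-assocʳ p m k) (trans (cong (p ^_) (ℕₚ.*-comm m k)) (sym (^-assocʳ p k m)))

kᵏ-pos : ∀ k → 0ℚ <ℚ fromℕ k ^ k
kᵏ-pos zero    = 0<1
kᵏ-pos (suc j) = ^-pos (suc j) (fromℕ-pos j)

monomial≡ : ∀ k (x y : Fin n → ℚ) → monomial n (suc k) x y ≡ ∏ x * ∏ (λ v → y v ^ k)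
monomial≡ {n} k x y = cong₂ _*_
  (trans (prodℚ≡∏ n _) (sum-cong-≗ {n} λ u → ℚₚ.*-identityʳ (x u)))
  (trans (prodℚ≡∏ n _) (sum-cong-≗ {n} λ v → ^ℚ≡^ (y v) k))

monomial-const : ∀ k t → monomial n (suc k) (λ _ → 1ℚ) (λ _ → t) ≡ (t ^ k) ^ n
monomial-const {n} k t = begin
  monomial n (suc k) (λ _ → 1ℚ) (λ _ → t)          ≡⟨ monomial≡ {n} k (λ _ → 1ℚ) (λ _ → t) ⟩
  ∏ {n} (λ _ → 1ℚ) * ∏ {n} (λ _ → t ^ k)           ≡⟨ cong₂ _*_ (sum-replicate-zero n) (sum-replicate n) ⟩
  1ℚ * (t ^ k) ^ n                                 ≡⟨ ℚₚ.*-identityˡ _ ⟩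
  (t ^ k) ^ n                                      ∎
  where open ≡-Reasoning

RatioApproaches : (n : ℕ) → ((Fin n → ℚ) → (Fin n → ℚ) → ℚ) → ((Fin n → ℚ) → (Fin n → ℚ) → ℚ) → ℚ → Set
RatioApproaches n P M c =
  ∀ ε → 0ℚ <ℚ ε → Σ (Fin n → ℚ) λ x → Σ (Fin n → ℚ) λ y → Pos x × Pos y × (P x y <ℚ (c + ε) * M x y)

attained⇒approaches : {P M : (Fin n → ℚ) → (Fin n → ℚ) → ℚ} {c : ℚ} (x y : Fin n → ℚ) →
                      Pos x → Pos y → 0ℚ <ℚ M x y → P x y ≡ c * M x y → RatioApproaches n P M c
attained⇒approaches {P = P} {M} {c} x y px py 0<M P≡cM ε 0<ε = x , y , px , py , (begin-strict
  P x y                   ≡⟨ P≡cM ⟩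
  c * M x y               <⟨ p<p+q (*-pos 0<ε 0<M) ⟩
  c * M x y + ε * M x y   ≡⟨ ℚₚ.*-distribʳ-+ (M x y) c ε ⟨
  (c + ε) * M x y         ∎)
  where open ℚₚ.≤-Reasoning

module _ {n : ℕ} (G : BipGraph n) where

  edgeProd : (Fin n → Fin n → ℚ) → ℚ
  edgeProd f = ∏ λ u → ∏ λ v → f u v ^[ G u v ]

  PG≡edgeProd : ∀ x y → PG G x y ≡ edgeProd (λ u v → x u + y v)
  PG≡edgeProd x y = trans (prodℚ≡∏ n _) (sum-cong-≗ {n} λ u → prodℚ≡∏ n _)

  edgeProd-distrib-* : ∀ f g → edgeProd (λ u v → f u v * g u v) ≡ edgeProd f * edgeProd g
  edgeProd-distrib-* f g = trans
    (sum-cong-≗ {n} λ u → trans (sum-cong-≗ {n} λ v → *-^[] (G u v) (f u v) (g u v)) (∑-distrib-+ {n} _ _))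
    (∑-distrib-+ {n} _ _)

  edgeProd-^ : ∀ f k → edgeProd (λ u v → f u v ^ k) ≡ edgeProd f ^ k
  edgeProd-^ f k = trans
    (sum-cong-≗ {n} λ u → trans (sum-cong-≗ {n} λ v → ^-^[] (G u v) (f u v) k) (∏-^ {n} _ k))
    (∏-^ {n} _ k)

  edgeProd-nonNeg : ∀ f → (∀ u v → 0ℚ ≤ℚ f u v) → 0ℚ ≤ℚ edgeProd f
  edgeProd-nonNeg f 0≤f = ∏-nonNeg {n} _ λ u → ∏-nonNeg {n} _ λ v → ^[]-nonNeg (G u v) (0≤f u v)

  edgeProd-mono-≤ : ∀ f g → (∀ u v → 0ℚ ≤ℚ f u v) → (∀ u v → f u v ≤ℚ g u v) → edgeProd f ≤ℚ edgeProd g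
  edgeProd-mono-≤ f g 0≤f f≤g = ∏-mono-≤ {n} _ _
    (λ u → ∏-nonNeg {n} _ λ v → ^[]-nonNeg (G u v) (0≤f u v))
    (λ u → ∏-mono-≤ {n} _ _ (λ v → ^[]-nonNeg (G u v) (0≤f u v)) (λ v → ^[]-mono-≤ (G u v) (f≤g u v)))

  edgeProd-left : ∀ {d} → (∀ u → degA G u ≡ d) → ∀ x → edgeProd (λ u _ → x u) ≡ ∏ x ^ d
  edgeProd-left {d} regA x = trans
    (sum-cong-≗ {n} λ u → trans (∏-^[] (x u) (G u)) (cong (x u ^_) (regA u)))
    (∏-^ {n} x d)

  edgeProd-right : ∀ {d} → (∀ v → degB G v ≡ d) → ∀ y → edgeProd (λ _ v → y v) ≡ ∏ y ^ d
  edgeProd-right {d} regB y = trans (∑-comm (λ u v → y v ^[ G u v ])) (trans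
    (sum-cong-≗ {n} λ v → trans (∏-^[] (y v) (λ u → G u v)) (cong (y v ^_) (regB v)))
    (∏-^ {n} y d))

  edgeProd-const : ∀ {d} → (∀ u → degA G u ≡ d) → ∀ c → edgeProd (λ _ _ → c) ≡ (c ^ n) ^ d
  edgeProd-const {d} regA c = trans (edgeProd-left regA (λ _ → c)) (cong (_^ d) (sum-replicate n))

  PG-const : ∀ {d} → (∀ u → degA G u ≡ d) → ∀ s t → PG G (λ _ → s) (λ _ → t) ≡ ((s + t) ^ n) ^ d
  PG-const regA s t = trans (PG≡edgeProd (λ _ → s) (λ _ → t)) (edgeProd-const regA (s + t))

  edgeProd-separable : ∀ {d} → Regular d G → ∀ a x w →
                       edgeProd (λ u v → a * (x u * w v)) ≡ (a ^ n * (∏ x * ∏ w)) ^ d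
  edgeProd-separable {d} (regA , regB) a x w = begin
    edgeProd (λ u v → a * (x u * w v))
      ≡⟨ edgeProd-distrib-* (λ _ _ → a) (λ u v → x u * w v) ⟩
    edgeProd (λ _ _ → a) * edgeProd (λ u v → x u * w v)
      ≡⟨ cong (edgeProd (λ _ _ → a) *_) (edgeProd-distrib-* (λ u _ → x u) (λ _ v → w v)) ⟩
    edgeProd (λ _ _ → a) * (edgeProd (λ u _ → x u) * edgeProd (λ _ v → w v))
      ≡⟨ cong₂ _*_ (edgeProd-const regA a) (cong₂ _*_ (edgeProd-left regA x) (edgeProd-right regB w)) ⟩
    (a ^ n) ^ d * (∏ x ^ d * ∏ w ^ d)
      ≡⟨ cong ((a ^ n) ^ d *_) (^-distrib-* (∏ x) (∏ w) d) ⟨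
    (a ^ n) ^ d * (∏ x * ∏ w) ^ d
      ≡⟨ ^-distrib-* (a ^ n) (∏ x * ∏ w) d ⟨
    (a ^ n * (∏ x * ∏ w)) ^ d
      ∎
    where open ≡-Reasoning

  edgeProd-scaled-PG : ∀ {d} → (∀ u → degA G u ≡ d) → ∀ b x y →
                       edgeProd (λ u v → b * (x u + y v) ^ d) ≡ (b ^ n * PG G x y) ^ d
  edgeProd-scaled-PG {d} regA b x y = begin
    edgeProd (λ u v → b * (x u + y v) ^ d)                     ≡⟨ edgeProd-distrib-* (λ _ _ → b) _ ⟩
    edgeProd (λ _ _ → b) * edgeProd (λ u v → (x u + y v) ^ d)  ≡⟨ cong₂ _*_ (edgeProd-const regA b) (edgeProd-^ _ d) ⟩
    (b ^ n) ^ d * edgeProd (λ u v → x u + y v) ^ d              ≡⟨ cong (λ P → (b ^ n) ^ d * P ^ d) (PG≡edgeProd x y) ⟨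
    (b ^ n) ^ d * PG G x y ^ d                                 ≡⟨ ^-distrib-* (b ^ n) (PG G x y) d ⟨
    (b ^ n * PG G x y) ^ d                                     ∎
    where open ≡-Reasoning

  PG-nonNeg : ∀ x y → Pos x → Pos y → 0ℚ ≤ℚ PG G x y
  PG-nonNeg x y px py = ℚₚ.≤-trans (edgeProd-nonNeg _ λ u v → +-nonNeg (ℚₚ.<⇒≤ (px u)) (ℚₚ.<⇒≤ (py v)))
                                   (ℚₚ.≤-reflexive (sym (PG≡edgeProd x y)))

  am-gm-over-edges : ∀ {k} → Regular (suc k) G → ∀ x y → Pos x → Pos y →
    (fromℕ (suc k) ^ suc k) ^ n * (∏ x * ∏ (λ v → y v ^ k)) ≤ℚ (fromℕ k ^ k) ^ n * PG G x y
  am-gm-over-edges {k} reg@(regA , _) x y px py = ^-cancel-≤ k 0≤bⁿP (begin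
    (a ^ n * (∏ x * ∏ w)) ^ suc k               ≡⟨ edgeProd-separable reg a x w ⟨
    edgeProd (λ u v → a * (x u * w v))          ≤⟨ edgeProd-mono-≤ _ _ 0≤axw (λ u v → weighted-am-gm k (px u) (py v)) ⟩
    edgeProd (λ u v → b * (x u + y v) ^ suc k)  ≡⟨ edgeProd-scaled-PG regA b x y ⟩
    (b ^ n * PG G x y) ^ suc k                  ∎)
    where
    open ℚₚ.≤-Reasoning
    a = fromℕ (suc k) ^ suc k
    b = fromℕ k ^ k
    w = λ v → y v ^ k
    0≤axw : ∀ u v → 0ℚ ≤ℚ a * (x u * w v)
    0≤axw u v = *-nonNeg (^-nonNeg (suc k) (fromℕ-nonNeg (suc k)))
                         (*-nonNeg (ℚₚ.<⇒≤ (px u)) (^-nonNeg k (ℚₚ.<⇒≤ (py v))))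
    0≤bⁿP : 0ℚ ≤ℚ b ^ n * PG G x y
    0≤bⁿP = *-nonNeg (^-nonNeg n (ℚₚ.<⇒≤ (kᵏ-pos k))) (PG-nonNeg x y px py)

  capValue-lowerBound : ∀ {k} → Regular (suc k) G → ∀ x y → Pos x → Pos y →
                        capValue n (suc k) * monomial n (suc k) x y ≤ℚ PG G x y
  capValue-lowerBound {k} reg x y px py = ℚₚ.*-cancelˡ-≤-pos (b ^ n) {{ℚ.positive (^-pos n (kᵏ-pos k))}} (begin
    b ^ n * (c * M)                       ≡⟨ solve 3 (λ B c M → B :* (c :* M) := c :* B :* M) refl (b ^ n) c M ⟩
    c * b ^ n * M                         ≡⟨ cong₂ _*_ (capValue-as-ratio n k) (monomial≡ k x y) ⟩
    a ^ n * (∏ x * ∏ (λ v → y v ^ k))     ≤⟨ am-gm-over-edges reg x y px py ⟩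
    b ^ n * PG G x y                      ∎)
    where
    open ℚₚ.≤-Reasoning
    a = fromℕ (suc k) ^ suc k
    b = fromℕ k ^ k
    c = capValue n (suc k)
    M = monomial n (suc k) x y

  capValue-attained : ∀ {j} → Regular (suc (suc j)) G →
                      RatioApproaches n (PG G) (monomial n (suc (suc j))) (capValue n (suc (suc j)))
  capValue-attained {j} (regA , _) =
    attained⇒approaches {P = PG G} {monomial n (suc k)} {c}
      (λ _ → 1ℚ) (λ _ → K) (λ _ → 0<1) (λ _ → fromℕ-pos j) 0<M P≡cM
    where
    open ≡-Reasoning
    k = suc j
    K = fromℕ k
    c = capValue n (suc k)
    0<M : 0ℚ <ℚ monomial n (suc k) (λ _ → 1ℚ) (λ _ → K)
    0<M = ℚₚ.<-≤-trans (^-pos n (kᵏ-pos k)) (ℚₚ.≤-reflexive (sym (monomial-const {n} k K)))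
    P≡cM : PG G (λ _ → 1ℚ) (λ _ → K) ≡ c * monomial n (suc k) (λ _ → 1ℚ) (λ _ → K)
    P≡cM = begin
      PG G (λ _ → 1ℚ) (λ _ → K)                     ≡⟨ PG-const regA 1ℚ K ⟩
      ((1ℚ + K) ^ n) ^ suc k                        ≡⟨ ^-^-comm (1ℚ + K) n (suc k) ⟩
      ((1ℚ + K) ^ suc k) ^ n                        ≡⟨ capValue-as-ratio n k ⟨
      c * (K ^ k) ^ n                               ≡⟨ cong (c *_) (monomial-const {n} k K) ⟨
      c * monomial n (suc k) (λ _ → 1ℚ) (λ _ → K)   ∎

  ratio-at-[1,δ]<1+ε : Regular 1 G → ∀ {δ ε} → 0ℚ <ℚ δ → δ ≤ℚ 1ℚ → δ * mersenne n <ℚ ε →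
                       PG G (λ _ → 1ℚ) (λ _ → δ) <ℚ (1ℚ + ε) * monomial n 1 (λ _ → 1ℚ) (λ _ → δ)
  ratio-at-[1,δ]<1+ε (regA , _) {δ} {ε} 0<δ δ≤1 δB<ε = begin-strict
    PG G (λ _ → 1ℚ) (λ _ → δ)                      ≡⟨ PG-const regA 1ℚ δ ⟩
    ((1ℚ + δ) ^ n) ^ 1                             ≡⟨ ℚₚ.*-identityʳ _ ⟩
    (1ℚ + δ) ^ n                                   ≤⟨ [1+δ]^n≤1+δ*mersenne n (ℚₚ.<⇒≤ 0<δ) δ≤1 ⟩
    1ℚ + δ * mersenne n                            <⟨ ℚₚ.+-monoʳ-< 1ℚ δB<ε ⟩
    1ℚ + ε                                         ≡⟨ ℚₚ.*-identityʳ _ ⟨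
    (1ℚ + ε) * 1ℚ                                  ≡⟨ cong ((1ℚ + ε) *_) (trans (monomial-const {n} 0 δ) (1^n≡1 n)) ⟨
    (1ℚ + ε) * monomial n 1 (λ _ → 1ℚ) (λ _ → δ)   ∎
    where open ℚₚ.≤-Reasoning

  capValue-approached : Regular 1 G → RatioApproaches n (PG G) (monomial n 1) (capValue n 1)
  capValue-approached reg ε 0<ε =
    let δ , 0<δ , δ≤1 , δB<ε = small-δ (mersenne-nonNeg n) 0<ε
    in (λ _ → 1ℚ) , (λ _ → δ) , (λ _ → 0<1) , (λ _ → 0<δ) , ratio-at-[1,δ]<1+ε reg 0<δ δ≤1 δB<ε

lemma3p1 : (d n : ℕ) → 1 ≤ d → (G : BipGraph n) → Regular d G →
    Capacity d G (capValue n d)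
lemma3p1 zero          n () G reg
lemma3p1 (suc zero)    n _ G reg = capValue-lowerBound G reg , capValue-approached G reg
lemma3p1 (suc (suc j)) n _ G reg = capValue-lowerBound G reg , capValue-attained G reg
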